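{- Every language defined by a predecessor Horn formula with diagonal input-output in normal form is in $\mathtt{RealTime}_{\mathtt{IA}}$, i.e., is accepted in real time by an iterative array.
   Context: Word structures: for a finite alphabet $\Sigma$ and a nonempty word $w=w_1\dots w_n\in\Sigma^n$, let $\langle w\rangle=([1,n];(Q_s)_{s\in\Sigma},\mathtt{min},\mathtt{max},\mathtt{suc},\mathtt{pred})$ with $Q_s(i)\iff w_i=s$, $\mathtt{min}(i)\iff i=1$, $\mathtt{max}(i)\iff i=n$, $\mathtt{pred}(i)=i-1$ for $i>1$, $\mathtt{pred}(1)=1$ (and $\mathtt{suc}$ symmetrically); $x-1$ denotes $\mathtt{pred}(x)$. A formula $\Phi$ defines $\{w\in\Sigma^+:\langle w\rangle\models\Phi\}$. A predecessor Horn formula with diagonal input-output in normal form is $\Phi=\exists\mathbf{R}\,\forall x\forall y\,\psi(x,y)$ with $\mathbf{R}$ a finite set of binary predicate symbols and $\psi$ a finite conjunction of clauses of the forms: input clauses $x=y\wedge\mathtt{min}(x)\wedge Q_s(x)\to R(x,y)$ or $x=y\wedge\neg\mathtt{min}(x)\wedge Q_s(x)\to R(x,y)$ ($s\in\Sigma$, $R\in\mathbf{R}$); the contradiction clause $\mathtt{max}(x)\wedge\mathtt{max}(y)\wedge R_\bot(x,y)\to\bot$ for a fixed $R_\bot\in\mathbf{R}$; computation clauses $\delta_1\wedge\dots\wedge\delta_r\to R(x,y)$ with each $\delta_i$ of the form $S(x-1,y)\wedge\neg\mathtt{min}(x)$ or $S(x,y-1)\wedge\neg\mathtt{min}(y)$,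 $S\in\mathbf{R}$. Iterative arrays: cells indexed by $[1,n]$, finite state set $Q$, cells outside $[1,n]$ permanently in a state $\sharp$, cells initially in a quiescent state $\lambda$; the state of cell $c$ at time $t$ is determined by the states of cells $c-1,c,c+1$ at time $t-1$, and the first cell at time $i$ additionally reads the input letter $w_i$ (sequential input). $\mathtt{RealTime}_{\mathtt{IA}}$: languages $L$ for which such an IA with a set of accepting states exists such that $w\in L$ iff cell 1 is in an accepting state at time $n$. -}

module Defs where

open import Data.Nat using (ℕ; zero; suc)
open import Data.Fin using (Fin; zero; suc; inject₁; fromℕ)
open import Data.Bool using (Bool; true; false)
open import Data.Maybe using (Maybe; just; nothing)
import Data.Maybe as Maybe
open import Data.List using (List)
import Data.List as List
open import Data.List.NonEmpty using (List⁺)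
import Data.List.NonEmpty as List⁺
open import Data.List.Relation.Unary.All using (All)
open import Data.Vec using (Vec; lookup; toList)
open import Data.Product using (Σ; _×_; _,_)
open import Data.Empty using (⊥)
open import Relation.Nullary using (¬_)
open import Relation.Binary.PropositionalEquality using (_≡_)

-- Conventions
--  * The finite alphabet Σ is  Fin k.
--  * A nonempty word of length N = suc n is a  Vec (Fin k) (suc n).
--  * Positions [1,N] are  Fin (suc n)  with  zero  standing for position 1
--    and  fromℕ n  for position N.

predF : ∀ {m} → Fin (suc m) → Fin (suc m)
predF zero    = zero
predF (suc i) = inject₁ i

-- the two kinds of hypotheses  S(x-1,y) ∧ ¬min(x)  and  S(x,y-1) ∧ ¬min(y)
data Dir : Set where
  decX decY : Dir

record InputClause (k r : ℕ) : Set where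
  field
    atMin  : Bool     -- true : x=y ∧ min(x) ∧ Q_s(x) → R(x,y)
                      -- false: x=y ∧ ¬min(x) ∧ Q_s(x) → R(x,y)
    letter : Fin k
    concl  : Fin r

record CompClause (r : ℕ) : Set where
  field
    hyps  : List⁺ (Dir × Fin r)
    concl : Fin r

-- Φ = ∃R ∀x∀y ψ(x,y); the predicate symbols are Fin r
record HornNF (k : ℕ) : Set where
  field
    r       : ℕ
    Rbot    : Fin r
    inputs  : List (InputClause k r)
    comps   : List (CompClause r)

Interp : ℕ → ℕ → Set
Interp r N = Fin r → Fin N → Fin N → Bool

module _ {k n r : ℕ} (w : Vec (Fin k) (suc n)) (ρ : Interp r (suc n)) where

  minCond : Bool → Fin (suc n) → Set
  minCond true  x = x ≡ zero
  minCond false x = ¬ (x ≡ zero)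

  InputSat : InputClause k r → Set
  InputSat c = ∀ (x y : Fin (suc n)) → x ≡ y → minCond (InputClause.atMin c) x →
               lookup w x ≡ InputClause.letter c → ρ (InputClause.concl c) x y ≡ true

  AtomHolds : Fin (suc n) → Fin (suc n) → Dir × Fin r → Set
  AtomHolds x y (decX , S) = ρ S (predF x) y ≡ true × ¬ (x ≡ zero)
  AtomHolds x y (decY , S) = ρ S x (predF y) ≡ true × ¬ (y ≡ zero)

  CompSat : CompClause r → Set
  CompSat c = ∀ (x y : Fin (suc n)) →
              All (AtomHolds x y) (List⁺.toList (CompClause.hyps c)) →
              ρ (CompClause.concl c) x y ≡ true

  ContraSat : Fin r → Set
  ContraSat Rb = ∀ (x y : Fin (suc n)) → x ≡ fromℕ n → y ≡ fromℕ n →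
                 ρ Rb x y ≡ true → ⊥

Models : ∀ {k n} → HornNF k → Vec (Fin k) (suc n) → Set
Models {k} {n} Φ w =
  Σ (Interp (HornNF.r Φ) (suc n)) λ ρ →
      All (InputSat w ρ) (HornNF.inputs Φ)
    × ContraSat w ρ (HornNF.Rbot Φ)
    × All (CompSat w ρ) (HornNF.comps Φ)

-- Iterative arrays (sequential input at cell 1, real-time acceptance)
-- The boundary state ♯ is represented by  nothing : Maybe (Fin q).

record IA (k : ℕ) : Set where
  field
    q         : ℕ
    quiescent : Fin q
    δ₁        : Fin k → Maybe (Fin q) → Fin q → Maybe (Fin q) → Fin q
    δ         : Maybe (Fin q) → Fin q → Maybe (Fin q) → Fin q
    accepting : Fin q → Bool

rightIdx : ∀ {N} → Fin N → Maybe (Fin N)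
rightIdx {suc zero}    zero    = nothing
rightIdx {suc (suc N)} zero    = just (suc zero)
rightIdx {suc (suc N)} (suc i) = Maybe.map suc (rightIdx i)

module _ {k : ℕ} (A : IA k) where
  open IA A

  Config : ℕ → Set
  Config N = Fin N → Fin q

  initial : ∀ {N} → Config N
  initial _ = quiescent

  step : ∀ {N} → Fin k → Config N → Config N
  step a c zero    = δ₁ a nothing (c zero) (Maybe.map c (rightIdx {_} zero))
  step a c (suc i) = δ (just (c (inject₁ i))) (c (suc i)) (Maybe.map c (rightIdx (suc i)))

  runIA : ∀ {n} → Vec (Fin k) (suc n) → Config (suc n)
  runIA w = List.foldl (λ c a → step a c) initial (toList w)

  Accepts : ∀ {n} → Vec (Fin k) (suc n) → Set
  Accepts w = accepting (runIA w zero) ≡ true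

-- The facts at a grid point (x, y) are those derivable from the facts at (x - 1, y) and
-- (x, y - 1) by the computation clauses, together with those given by the input clauses when
-- x = y.  These facts hold in every model of ψ, and they form one unless R_⊥ is among the facts
-- at (N, N).  An iterative array computes the grid along anti-diagonals: at time t cell j holds
-- the facts at (t + j - 1, t - j + 1) and at (t - j + 1, t + j - 1).  A time step advances by
-- two anti-diagonals; the intermediate one has odd coordinate sum, so it misses the diagonal and
-- needs no input, while the new diagonal point is computed by cell 1 from the letter it reads.
-- So at time N cell 1 holds the facts at (N, N).

module Submission where

open import Defs
open import Data.Bool using (Bool; true; false; not; if_then_else_)
import Data.Bool as Bool
open import Data.Empty using (⊥; ⊥-elim)
open import Data.Fin using (Fin; zero; suc; toℕ; inject₁; fromℕ)
import Data.Fin as Fin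
open import Data.Fin.Properties using (2↔Bool; *↔×; toℕ-inject₁; toℕ-fromℕ; toℕ-injective)
open import Data.List using (applyUpTo; foldl)
import Data.List as List
import Data.List.NonEmpty as List⁺
open import Data.List.Relation.Unary.All as All using (All; _∷_; all?)
open import Data.List.Membership.Propositional using (_∈_; find; lose)
open import Data.List.Relation.Unary.Any using (Any; any?; satisfied)
open import Data.List.Properties using (applyUpTo-∷ʳ; foldl-∷ʳ)
open import Data.Maybe using (Maybe; just; nothing; maybe)
import Data.Maybe as Maybe
open import Data.Maybe.Properties using (map-∘)
open import Data.Nat using (ℕ; zero; suc; _+_; _*_; _^_; _≤_; z≤n; s≤s; _≟_; _≡ᵇ_)
open import Data.Nat.Properties
  using (≤-refl; <⇒≤; m≤n⇒m≤1+n; m≤n+m; +-suc; <⇒≢; >⇒≢; suc-injective)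
open import Data.Product using (Σ; _×_; _,_; uncurry)
open import Data.Product.Function.NonDependent.Propositional using (_×-↔_)
open import Data.Sum using (_⊎_; inj₁; inj₂)
open import Data.Vec using (Vec; []; _∷_; lookup; tabulate; toList)
open import Data.Vec.Properties using (lookup∘tabulate; tabulate-cong)
open import Function using (_∘_; flip)
open import Function.Bundles using (_⇔_; mk⇔; _↔_; Inverse; Equivalence; mk↔ₛ′)
open import Function.Construct.Composition using (_↔-∘_; _⇔-∘_)
open import Function.Construct.Symmetry using (⇔-sym)
open import Relation.Nullary using (¬_; Dec; yes; no; does)
open import Relation.Nullary.Decidable using (dec-true; dec-false; _×-dec_; _⊎-dec_; ¬?)
open import Relation.Binary.PropositionalEquality
  using (_≡_; _≢_; refl; sym; trans; cong; cong₂; subst; module ≡-Reasoning)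

does≡true⇔ : ∀ {A : Set} (a? : Dec A) → does a? ≡ true ⇔ A
does≡true⇔ (yes a) = mk⇔ (λ _ → a) (λ _ → refl)
does≡true⇔ (no ¬a) = mk⇔ (λ ()) (⊥-elim ∘ ¬a)

∷↔ : ∀ {A : Set} {m} → (A × Vec A m) ↔ Vec A (suc m)
∷↔ = mk↔ₛ′ (uncurry _∷_) (λ { (x ∷ xs) → x , xs }) (λ { (x ∷ xs) → refl }) (λ _ → refl)

2^↔Vec-Bool : ∀ m → Fin (2 ^ m) ↔ Vec Bool m
2^↔Vec-Bool zero    = mk↔ₛ′ (λ _ → []) (λ _ → zero) (λ { [] → refl }) (λ { zero → refl })
2^↔Vec-Bool (suc m) = (∷↔ ↔-∘ (2↔Bool ×-↔ 2^↔Vec-Bool m)) ↔-∘ *↔×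

-- Past the end of the word the last letter is repeated.
letterAt : ∀ {A : Set} {n} → Vec A (suc n) → ℕ → A
letterAt (a ∷ _)      zero    = a
letterAt (a ∷ [])     (suc t) = a
letterAt (_ ∷ b ∷ as) (suc t) = letterAt (b ∷ as) t

lookup≡letterAt : ∀ {A : Set} {n} (w : Vec A (suc n)) i → lookup w i ≡ letterAt w (toℕ i)
lookup≡letterAt (a ∷ _)      zero    = refl
lookup≡letterAt (_ ∷ b ∷ as) (suc i) = lookup≡letterAt (b ∷ as) i

toList≡applyUpTo-letterAt : ∀ {A : Set} {n} (w : Vec A (suc n)) →
                            toList w ≡ applyUpTo (letterAt w) (suc n)
toList≡applyUpTo-letterAt (a ∷ [])     = refl
toList≡applyUpTo-letterAt (a ∷ b ∷ as) = cong (a List.∷_) (toList≡applyUpTo-letterAt (b ∷ as))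

module EncodedArray {k q : ℕ} {S : Set} (code : Fin q ↔ S) (quiet : S)
                    (rule₁ : Fin k → S → S → S) (rule : S → S → S → S) (accept : S → Bool) where
  open Inverse code using (to; from; strictlyInverseˡ)
  open ≡-Reasoning

  neighbour : Maybe (Fin q) → S
  neighbour = maybe to quiet

  array : IA k
  array = record
    { q         = q
    ; quiescent = from quiet
    ; δ₁        = λ a _ c r → from (rule₁ a (to c) (neighbour r))
    ; δ         = λ l c r → from (rule (neighbour l) (to c) (neighbour r))
    ; accepting = accept ∘ to
    }

  diagram : (ℕ → Fin k) → ℕ → ℕ → S
  diagram lt zero    c       = quiet
  diagram lt (suc t) zero    = rule₁ (lt t) (diagram lt t 0) (diagram lt t 1)
  diagram lt (suc t) (suc c) =
    rule (diagram lt t c) (diagram lt t (suc c)) (diagram lt t (suc (suc c)))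

  diagram-unique : ∀ lt (E : ℕ → ℕ → S) →
    (∀ c → E zero c ≡ quiet) →
    (∀ t → E (suc t) zero ≡ rule₁ (lt t) (E t 0) (E t 1)) →
    (∀ t c → E (suc t) (suc c) ≡ rule (E t c) (E t (suc c)) (E t (suc (suc c)))) →
    ∀ t c → diagram lt t c ≡ E t c
  diagram-unique lt E E₀ E₁ E₂ = go
    where
    go : ∀ t c → diagram lt t c ≡ E t c
    go zero    c = sym (E₀ c)
    go (suc t) zero rewrite go t 0 | go t 1 = sym (E₁ t)
    go (suc t) (suc c) rewrite go t c | go t (suc c) | go t (suc (suc c)) = sym (E₂ t c)

  stepᴬ : ∀ {N} → (Fin N → Fin q) → Fin k → Fin N → Fin q
  stepᴬ c a = step array a c

  Agrees : ∀ {N} → (Fin N → Fin q) → (ℕ → S) → Set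
  Agrees cfg row = ∀ i → to (cfg i) ≡ row (toℕ i)

  right-neighbour : ∀ {N} (cfg : Fin N → Fin q) (row : ℕ → S) → Agrees cfg row → row N ≡ quiet →
                    ∀ i → neighbour (Maybe.map cfg (rightIdx i)) ≡ row (suc (toℕ i))
  right-neighbour {suc zero}    cfg row agree end zero    = sym end
  right-neighbour {suc (suc N)} cfg row agree end zero    = agree (suc zero)
  right-neighbour {suc (suc N)} cfg row agree end (suc i) =
    trans (cong neighbour (sym (map-∘ (rightIdx i))))
          (right-neighbour (cfg ∘ suc) (row ∘ suc) (agree ∘ suc) end i)

  module _ (quiet-stable : rule quiet quiet quiet ≡ quiet) (lt : ℕ → Fin k) where

    diagram-quiet : ∀ {t c} → t ≤ c → diagram lt t c ≡ quiet
    diagram-quiet {zero}              _         = refl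
    diagram-quiet {suc t} {suc c} (s≤s t≤c)
      rewrite diagram-quiet t≤c | diagram-quiet (m≤n⇒m≤1+n t≤c)
            | diagram-quiet (m≤n⇒m≤1+n (m≤n⇒m≤1+n t≤c)) = quiet-stable

    step-agrees : ∀ {n} t (cfg : Fin (suc n) → Fin q) → t ≤ suc n →
                  Agrees cfg (diagram lt t) → Agrees (step array (lt t) cfg) (diagram lt (suc t))
    step-agrees t cfg t≤N agree zero
      rewrite agree zero | right-neighbour cfg (diagram lt t) agree (diagram-quiet t≤N) zero
      = strictlyInverseˡ _
    step-agrees t cfg t≤N agree (suc i)
      rewrite agree (inject₁ i) | toℕ-inject₁ i | agree (suc i)
            | right-neighbour cfg (diagram lt t) agree (diagram-quiet t≤N) (suc i)
      = strictlyInverseˡ _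

    run-agrees : ∀ {n} t → t ≤ suc n →
                 Agrees {suc n} (foldl stepᴬ (initial array) (applyUpTo lt t)) (diagram lt t)
    run-agrees zero    _   _ = strictlyInverseˡ quiet
    run-agrees (suc t) t<N i =
      trans (cong (λ cfg → to (cfg i)) (begin
        foldl stepᴬ (initial array) (applyUpTo lt (suc t))
          ≡⟨ cong (foldl stepᴬ _) (sym (applyUpTo-∷ʳ lt t)) ⟩
        foldl stepᴬ (initial array) (applyUpTo lt t List.∷ʳ lt t)
          ≡⟨ foldl-∷ʳ stepᴬ _ (lt t) (applyUpTo lt t) ⟩
        stepᴬ (foldl stepᴬ (initial array) (applyUpTo lt t)) (lt t) ∎))
        (step-agrees t _ (<⇒≤ t<N) (run-agrees t (<⇒≤ t<N)) i)

  runIA-agrees : rule quiet quiet quiet ≡ quiet → ∀ {n} (w : Vec (Fin k) (suc n)) →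
                 Agrees (runIA array w) (diagram (letterAt w) (suc n))
  runIA-agrees quiet-stable {n} w i =
    trans (cong (λ ls → to (foldl stepᴬ (initial array) ls i)) (toList≡applyUpTo-letterAt w))
          (run-agrees quiet-stable (letterAt w) (suc n) ≤-refl i)

module AntiDiagonal {A : Set} (e : A) (f : A → A → A) (G : ℕ → ℕ → A) where

  G↓ : ℕ → ℕ → A
  G↓ x zero    = e
  G↓ x (suc y) = G x y

  -- sweep d s c = G (d + s + c) (s - c) for c ≤ s, and e for c > s.
  sweep : ℕ → ℕ → ℕ → A
  sweep d s       zero    = G (d + s) s
  sweep d zero    (suc c) = e
  sweep d (suc s) (suc c) = sweep (suc (suc d)) s c

  module _ (f-e : f e e ≡ e)
           (G-step : ∀ {x y} → y ≤ x → G (suc x) y ≡ f (G x y) (G↓ (suc x) y)) where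

    sweep-half : ∀ d s c → f (sweep d s c) (sweep d s (suc c)) ≡ sweep (suc d) s c
    sweep-half d zero    zero    = sym (G-step z≤n)
    sweep-half d (suc s) zero    =
      sym (trans (G-step (m≤n+m (suc s) d))
                 (cong (λ x → f (G (d + suc s) (suc s)) (G (suc x) s)) (+-suc d s)))
    sweep-half d zero    (suc c) = f-e
    sweep-half d (suc s) (suc c) = sweep-half (suc (suc d)) s c

    sweep-suc : ∀ d s c →
      sweep d (suc s) (suc c) ≡
      f (f (sweep d s c) (sweep d s (suc c))) (f (sweep d s (suc c)) (sweep d s (suc (suc c))))
    sweep-suc d s c =
      sym (trans (cong₂ f (sweep-half d s c) (sweep-half d s (suc c))) (sweep-half (suc d) s c))

module LeastModel {k : ℕ} (Φ : HornNF k) where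
  open HornNF Φ
  module IC = InputClause
  module CC = CompClause

  Facts : Set
  Facts = Vec Bool r

  _∈ᶠ_ : Fin r → Facts → Set
  R ∈ᶠ A = lookup A R ≡ true

  _∈ᶠ?_ : ∀ R A → Dec (R ∈ᶠ A)
  R ∈ᶠ? A = lookup A R Bool.≟ true

  ∅ : Facts
  ∅ = tabulate λ _ → false

  ∉∅ : ∀ {R} → ¬ R ∈ᶠ ∅
  ∉∅ {R} R∈∅ with () ← trans (sym R∈∅) (lookup∘tabulate _ R)

  -- A holds the facts at (x - 1, y) and B those at (x, y - 1).
  Premise : Facts → Facts → Dir × Fin r → Set
  Premise A B (decX , S) = S ∈ᶠ A
  Premise A B (decY , S) = S ∈ᶠ B

  Fires : Facts → Facts → Fin r → CompClause r → Set
  Fires A B R c = CC.concl c ≡ R × All (Premise A B) (List⁺.toList (CC.hyps c))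

  -- The input is a letter together with whether the position is the minimum.
  Seeds : Fin k × Bool → Fin r → InputClause k r → Set
  Seeds (a , b) R ic = IC.atMin ic ≡ b × IC.letter ic ≡ a × IC.concl ic ≡ R

  Seeded : Maybe (Fin k × Bool) → Fin r → Set
  Seeded nothing    R = ⊥
  Seeded (just inp) R = Any (Seeds inp R) inputs

  Derivable : Maybe (Fin k × Bool) → Facts → Facts → Fin r → Set
  Derivable inp A B R = Any (Fires A B R) comps ⊎ Seeded inp R

  derivable? : ∀ inp A B R → Dec (Derivable inp A B R)
  derivable? inp A B R = any? fires? comps ⊎-dec seeded? inp
    where
    premise? : ∀ h → Dec (Premise A B h)
    premise? (decX , S) = S ∈ᶠ? A
    premise? (decY , S) = S ∈ᶠ? B
    fires? : ∀ c → Dec (Fires A B R c)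
    fires? c = CC.concl c Fin.≟ R ×-dec all? premise? (List⁺.toList (CC.hyps c))
    seeded? : ∀ inp → Dec (Seeded inp R)
    seeded? nothing        = no λ ()
    seeded? (just (a , b)) =
      any? (λ ic → IC.atMin ic Bool.≟ b ×-dec IC.letter ic Fin.≟ a ×-dec IC.concl ic Fin.≟ R) inputs

  infer : Maybe (Fin k × Bool) → Facts → Facts → Facts
  infer inp A B = tabulate λ R → does (derivable? inp A B R)

  ∈-infer : ∀ inp A B {R} → R ∈ᶠ infer inp A B ⇔ Derivable inp A B R
  ∈-infer inp A B {R} rewrite lookup∘tabulate (λ R → does (derivable? inp A B R)) R =
    does≡true⇔ (derivable? inp A B R)

  derive : Facts → Facts → Facts
  derive = infer nothing

  -- Every computation clause has a premise, and ∅ satisfies none.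
  derive-∅ : derive ∅ ∅ ≡ ∅
  derive-∅ = tabulate-cong λ R → dec-false (derivable? nothing ∅ ∅ R) underivable
    where
    no-premise : ∀ {h} → ¬ Premise ∅ ∅ h
    no-premise {decX , _} = ∉∅
    no-premise {decY , _} = ∉∅
    underivable : ∀ {R} → ¬ Derivable nothing ∅ ∅ R
    underivable (inj₁ fires) with _ , _ , p ∷ _ ← satisfied fires = no-premise p

  module Grid (lt : ℕ → Fin k) where

    diagonalInput : ℕ → ℕ → Maybe (Fin k × Bool)
    diagonalInput x y = if does (x ≟ y) then just (lt x , (x ≡ᵇ 0)) else nothing

    grid left below : ℕ → ℕ → Facts
    grid x y = infer (diagonalInput x y) (left x y) (below x y)
    left zero    y = ∅
    left (suc x) y = grid x y
    below x zero    = ∅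
    below x (suc y) = grid x y

    ∈-grid : ∀ x y {R} → R ∈ᶠ grid x y ⇔ Derivable (diagonalInput x y) (left x y) (below x y) R
    ∈-grid x y = ∈-infer (diagonalInput x y) (left x y) (below x y)

    diagonalInput-diag : ∀ x → diagonalInput x x ≡ just (lt x , (x ≡ᵇ 0))
    diagonalInput-diag x rewrite dec-true (x ≟ x) refl = refl

    diagonalInput-off : ∀ {x y} → x ≢ y → diagonalInput x y ≡ nothing
    diagonalInput-off {x} {y} x≢y rewrite dec-false (x ≟ y) x≢y = refl

    seeded-diagonal : ∀ {x y R} → Seeded (diagonalInput x y) R →
                      x ≡ y × Any (Seeds (lt x , (x ≡ᵇ 0)) R) inputs
    seeded-diagonal {x} {y} = seeded-if (x ≟ y)
      where
      seeded-if : ∀ {R} (x≟y : Dec (x ≡ y)) →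
                  Seeded (if does x≟y then just (lt x , (x ≡ᵇ 0)) else nothing) R →
                  x ≡ y × Any (Seeds (lt x , (x ≡ᵇ 0)) R) inputs
      seeded-if (yes x≡y) seeds = x≡y , seeds

    grid-step : ∀ {x y} → y ≤ x → grid (suc x) y ≡ derive (grid x y) (below (suc x) y)
    grid-step {x} {y} y≤x =
      cong (λ inp → infer inp (grid x y) (below (suc x) y)) (diagonalInput-off (>⇒≢ (s≤s y≤x)))

    gridᵀ-step : ∀ {x y} → y ≤ x → grid y (suc x) ≡ derive (left y (suc x)) (grid y x)
    gridᵀ-step {x} {y} y≤x =
      cong (λ inp → infer inp (left y (suc x)) (grid y x)) (diagonalInput-off (<⇒≢ (s≤s y≤x)))

  module _ {n : ℕ} (w : Vec (Fin k) (suc n)) where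
    open Grid (letterAt w)

    flag⇒minCond : ∀ {ρ : Interp r (suc n)} b (x : Fin (suc n)) → b ≡ (toℕ x ≡ᵇ 0) → minCond w ρ b x
    flag⇒minCond true  zero    _ = refl
    flag⇒minCond false (suc x) _ = λ ()

    minCond⇒flag : ∀ {ρ : Interp r (suc n)} b (x : Fin (suc n)) → minCond w ρ b x → b ≡ (toℕ x ≡ᵇ 0)
    minCond⇒flag true  zero    _   = refl
    minCond⇒flag false zero    x≢0 = ⊥-elim (x≢0 refl)
    minCond⇒flag false (suc x) _   = refl

    leastModel : Interp r (suc n)
    leastModel R x y = lookup (grid (toℕ x) (toℕ y)) R

    leastModel-input : ∀ {ic} → ic ∈ inputs → InputSat w leastModel ic
    leastModel-input {ic} ic∈ x _ refl min letter =
      Equivalence.from (∈-grid (toℕ x) (toℕ x)) (inj₂ (subst (λ inp → Seeded inp (IC.concl ic))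
        (sym (diagonalInput-diag (toℕ x)))
        (lose ic∈ (minCond⇒flag {leastModel} _ x min , trans (sym letter) (lookup≡letterAt w x) , refl))))

    atom⇒premise : ∀ {x y : Fin (suc n)} {h} → AtomHolds w leastModel x y h →
                   Premise (left (toℕ x) (toℕ y)) (below (toℕ x) (toℕ y)) h
    atom⇒premise {zero}      {h = decX , _} (_ , x≢0) = ⊥-elim (x≢0 refl)
    atom⇒premise {suc i} {y} {decX , S}     (S∈ , _)  =
      subst (λ a → S ∈ᶠ grid a (toℕ y)) (toℕ-inject₁ i) S∈
    atom⇒premise     {y = zero}  {decY , _} (_ , y≢0) = ⊥-elim (y≢0 refl)
    atom⇒premise {x} {suc j} {decY , S}     (S∈ , _)  =
      subst (λ b → S ∈ᶠ grid (toℕ x) b) (toℕ-inject₁ j) S∈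

    leastModel-comp : ∀ {c} → c ∈ comps → CompSat w leastModel c
    leastModel-comp c∈ x y atoms =
      Equivalence.from (∈-grid (toℕ x) (toℕ y)) (inj₁ (lose c∈ (refl , All.map atom⇒premise atoms)))

    leastModel-models : ¬ Rbot ∈ᶠ grid n n → Models Φ w
    leastModel-models Rbot∉ =
      leastModel , All.tabulate leastModel-input , contradiction , All.tabulate leastModel-comp
      where
      contradiction : ContraSat w leastModel Rbot
      contradiction _ _ refl refl = Rbot∉ ∘ subst (λ a → Rbot ∈ᶠ grid a a) (toℕ-fromℕ n)

    module _ {ρ : Interp r (suc n)}
             (inputs-sat : All (InputSat w ρ) inputs) (comps-sat : All (CompSat w ρ) comps) where

      grid⊆ : ∀ a b {x y} → toℕ x ≡ a → toℕ y ≡ b → ∀ {R} → R ∈ᶠ grid a b → ρ R x y ≡ true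
      premise⇒atom : ∀ a b {x y} → toℕ x ≡ a → toℕ y ≡ b → ∀ {h} →
                     Premise (left a b) (below a b) h → AtomHolds w ρ x y h

      seeded⇒ρ : ∀ a {x y} → toℕ x ≡ a → toℕ y ≡ a → ∀ {R} →
                 Any (Seeds (letterAt w a , (a ≡ᵇ 0)) R) inputs → ρ R x y ≡ true
      seeded⇒ρ a x≡a y≡a seeds with ic , ic∈ , min , letter , refl ← find seeds =
        All.lookup inputs-sat ic∈ _ _ (toℕ-injective (trans x≡a (sym y≡a)))
          (flag⇒minCond {ρ} _ _ (trans min (cong (_≡ᵇ 0) (sym x≡a))))
          (trans (lookup≡letterAt w _) (trans (cong (letterAt w) x≡a) (sym letter)))

      grid⊆ a b x≡a y≡b R∈ with Equivalence.to (∈-grid a b) R∈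
      ... | inj₁ fires with c , c∈ , refl , premises ← find fires =
        All.lookup comps-sat c∈ _ _ (All.map (premise⇒atom a b x≡a y≡b) premises)
      ... | inj₂ seeded with refl , seeds ← seeded-diagonal {a} {b} seeded =
        seeded⇒ρ a x≡a y≡b seeds

      premise⇒atom zero    b                 _   _   {decX , _} S∈ = ⊥-elim (∉∅ S∈)
      premise⇒atom (suc a) b {zero}          ()  _   {decX , _} S∈
      premise⇒atom (suc a) b {suc i}         x≡a y≡b {decX , _} S∈ =
        grid⊆ a b (trans (toℕ-inject₁ i) (suc-injective x≡a)) y≡b S∈ , λ ()
      premise⇒atom a zero                    _   _   {decY , _} S∈ = ⊥-elim (∉∅ S∈)
      premise⇒atom a (suc b) {y = zero}      _   ()  {decY , _} S∈
      premise⇒atom a (suc b) {y = suc j}     x≡a y≡b {decY , _} S∈ =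
        grid⊆ a b x≡a (trans (toℕ-inject₁ j) (suc-injective y≡b)) S∈ , λ ()

    models⇔ : Models Φ w ⇔ (¬ Rbot ∈ᶠ grid n n)
    models⇔ = mk⇔ (λ (_ , inputs-sat , contradiction , comps-sat) →
                     contradiction (fromℕ n) (fromℕ n) refl refl ∘
                     grid⊆ inputs-sat comps-sat n n (toℕ-fromℕ n) (toℕ-fromℕ n))
                  leastModel-models

module Construction {k : ℕ} (Φ : HornNF k) where
  open HornNF Φ using (r; Rbot)
  open LeastModel Φ

  -- Lower and upper facts of the invariant; the flag tells cell 1 whether it has read a letter.
  State : Set
  State = Bool × Facts × Facts

  quiet : State
  quiet = false , ∅ , ∅

  rule₁ : Fin k → State → State → State
  rule₁ a (started , lo , up) (_ , loʳ , upʳ) = true , D , D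
    where
    D : Facts
    D = infer (just (a , not started)) (derive upʳ up) (derive lo loʳ)

  rule : State → State → State → State
  rule (_ , loˡ , upˡ) (_ , lo , up) (_ , loʳ , upʳ) =
    false , derive (derive loˡ lo) (derive lo loʳ) , derive (derive upʳ up) (derive up upˡ)

  accept : State → Bool
  accept (_ , _ , up) = does (¬? (Rbot ∈ᶠ? up))

  code : Fin (2 * (2 ^ r * 2 ^ r)) ↔ State
  code = (2↔Bool ×-↔ ((2^↔Vec-Bool r ×-↔ 2^↔Vec-Bool r) ↔-∘ *↔×)) ↔-∘ *↔×

  open EncodedArray code quiet rule₁ rule accept public using (array; diagram-unique; runIA-agrees)

  rule-quiet : rule quiet quiet quiet ≡ quiet
  rule-quiet = cong (λ D → false , D , D) (trans (cong₂ derive derive-∅ derive-∅) derive-∅)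

  module _ (lt : ℕ → Fin k) where
    open Grid lt
    module L = AntiDiagonal ∅ derive grid
    module U = AntiDiagonal ∅ (flip derive) (flip grid)

    L-step : ∀ {x y} → y ≤ x → grid (suc x) y ≡ derive (grid x y) (L.G↓ (suc x) y)
    L-step {x} {zero}  = grid-step
    L-step {x} {suc y} = grid-step

    U-step : ∀ {x y} → y ≤ x → grid y (suc x) ≡ derive (U.G↓ (suc x) y) (grid y x)
    U-step {x} {zero}  = gridᵀ-step
    U-step {x} {suc y} = gridᵀ-step

    L-half : ∀ d s c → derive (L.sweep d s c) (L.sweep d s (suc c)) ≡ L.sweep (suc d) s c
    L-half = L.sweep-half derive-∅ L-step

    U-half : ∀ d s c → derive (U.sweep d s (suc c)) (U.sweep d s c) ≡ U.sweep (suc d) s c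
    U-half = U.sweep-half derive-∅ U-step

    expected : ℕ → ℕ → State
    expected zero    c = quiet
    expected (suc s) c = (c ≡ᵇ 0) , L.sweep 0 s c , U.sweep 0 s c

    expected-rule₁ : ∀ s → expected (suc s) 0 ≡ rule₁ (lt s) (expected s 0) (expected s 1)
    expected-rule₁ zero    =
      cong (λ D → true , D , D) (cong₂ (infer (just (lt 0 , true))) (sym derive-∅) (sym derive-∅))
    expected-rule₁ (suc s) = cong (λ D → true , D , D) (begin
      grid (suc s) (suc s)
        ≡⟨ cong (λ inp → infer inp (grid s (suc s)) (grid (suc s) s)) (diagonalInput-diag (suc s)) ⟩
      infer input (grid s (suc s)) (grid (suc s) s)
        ≡⟨ cong₂ (infer input) (sym (U-half 0 s 0)) (sym (L-half 0 s 0)) ⟩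
      infer input (derive (U.sweep 0 s 1) (grid s s)) (derive (grid s s) (L.sweep 0 s 1)) ∎)
      where
      open ≡-Reasoning
      input : Maybe (Fin k × Bool)
      input = just (lt (suc s) , false)

    expected-rule : ∀ s c →
      expected (suc s) (suc c) ≡ rule (expected s c) (expected s (suc c)) (expected s (suc (suc c)))
    expected-rule zero    c = sym rule-quiet
    expected-rule (suc s) c =
      cong₂ (λ lo up → false , lo , up) (L.sweep-suc derive-∅ L-step 0 s c)
                                        (U.sweep-suc derive-∅ U-step 0 s c)

  accepts⇔ : ∀ {n} (w : Vec (Fin k) (suc n)) →
             Accepts array w ⇔ (¬ Rbot ∈ᶠ Grid.grid (letterAt w) n n)
  accepts⇔ {n} w =
    subst (λ st → accept st ≡ true ⇔ (¬ Rbot ∈ᶠ D)) (sym cell₁) (does≡true⇔ (¬? (Rbot ∈ᶠ? D)))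
    where
    lt : ℕ → Fin k
    lt = letterAt w
    D : Facts
    D = Grid.grid lt n n
    cell₁ : Inverse.to code (runIA array w zero) ≡ expected lt (suc n) 0
    cell₁ = trans (runIA-agrees rule-quiet w zero)
                  (diagram-unique lt (expected lt) (λ _ → refl) (expected-rule₁ lt) (expected-rule lt)
                                  (suc n) 0)

lemma6 : ∀ {k : ℕ} (Φ : HornNF k) →
    Σ (IA k) λ A → ∀ (n : ℕ) (w : Vec (Fin k) (suc n)) → (Models Φ w ⇔ Accepts A w)
lemma6 Φ = array , λ n w → ⇔-sym (accepts⇔ w) ⇔-∘ models⇔ w
  where
  open LeastModel Φ using (models⇔)
  open Construction Φ using (array; accepts⇔)
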